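{- If there is a graph homomorphism from $H$ to $G$ and $G$ is vertex-transitive, then $\alpha^*(G|H)\le \dfrac{|\mathcal V(G)|}{|\mathcal V(H)|}$.
   Context: All graphs are finite, simple, undirected. A homomorphism $H\to G$ is a map $g:\mathcal V(H)\to\mathcal V(G)$ with $uv\in\mathcal E(H)\Rightarrow g(u)g(v)\in\mathcal E(G)$. $\boxtimes$ is the strong product and $\alpha^*(G|H)=\sup_W\frac{\alpha(G\boxtimes W)}{\alpha(H\boxtimes W)}$ over all graphs $W$. Vertex-transitive means the automorphism group acts transitively on vertices. -}

module Defs where

open import Data.Bool using (Bool; true; false; _∧_; _∨_; not)
open import Data.Bool.Properties using (∧-comm)
import Data.Nat
open import Data.Nat using (ℕ; zero; suc; _⊔_)
open import Data.Fin using (Fin; remQuot)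
open import Data.Fin.Properties using (_≟_)
open import Data.Fin.Subset using (Subset; ∣_∣)
open import Data.Fin.Permutation using (Permutation′; _⟨$⟩ʳ_)
open import Data.Vec using (Vec; []; _∷_; lookup)
open import Data.List using (List; []; _∷_; map; _++_; allFin; concatMap; foldr; filterᵇ)
open import Data.Product using (Σ; _,_; proj₁; proj₂)
open import Relation.Nullary.Decidable using (⌊_⌋; yes; no)
open import Data.Empty using (⊥-elim)
open import Relation.Binary.PropositionalEquality using (_≡_; refl; sym; cong; cong₂)

record Graph : Set where
  field
    n      : ℕ
    adj    : Fin n → Fin n → Bool
    adj-sym    : ∀ u v → adj u v ≡ adj v u
    adj-irrefl : ∀ v → adj v v ≡ false
open Graph public

∣V∣ : Graph → ℕ
∣V∣ = n

Hom : Graph → Graph → Set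
Hom H G = Σ (Fin (n H) → Fin (n G)) λ g →
  ∀ u v → adj H u v ≡ true → adj G (g u) (g v) ≡ true

IsAut : (G : Graph) → Permutation′ (n G) → Set
IsAut G σ = ∀ u v → adj G (σ ⟨$⟩ʳ u) (σ ⟨$⟩ʳ v) ≡ adj G u v

VertexTransitive : Graph → Set
VertexTransitive G = ∀ u v → Σ (Permutation′ (n G)) λ σ → Σ (IsAut G σ) λ _ → σ ⟨$⟩ʳ u ≡ v

-- Strong product: vertex (a , b) encoded as an element of Fin (n G * n W) via remQuot.
private
  eqᵇ : ∀ {m} → Fin m → Fin m → Bool
  eqᵇ a c = ⌊ a ≟ c ⌋

  eqᵇ-sym : ∀ {m} (a c : Fin m) → eqᵇ a c ≡ eqᵇ c a
  eqᵇ-sym a c with a ≟ c | c ≟ a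
  ... | yes _ | yes _ = refl
  ... | no _  | no _  = refl
  ... | yes p | no q  = ⊥-elim (q (sym p))
  ... | no q  | yes p = ⊥-elim (q (sym p))

  eqᵇ-refl : ∀ {m} (a : Fin m) → eqᵇ a a ≡ true
  eqᵇ-refl a with a ≟ a
  ... | yes _ = refl
  ... | no q  = ⊥-elim (q refl)

  sadj : (G W : Graph) → Fin (n G) → Fin (n W) → Fin (n G) → Fin (n W) → Bool
  sadj G W a b c d =
    (eqᵇ a c ∨ adj G a c) ∧ (eqᵇ b d ∨ adj W b d) ∧ not (eqᵇ a c ∧ eqᵇ b d)

  sadj-sym : ∀ G W a b c d → sadj G W a b c d ≡ sadj G W c d a b
  sadj-sym G W a b c d
    rewrite eqᵇ-sym a c | eqᵇ-sym b d | adj-sym G a c | adj-sym W b d = refl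

  sadj-irrefl : ∀ G W a b → sadj G W a b a b ≡ false
  sadj-irrefl G W a b rewrite eqᵇ-refl a | eqᵇ-refl b with (eqᵇ a a ∨ adj G a a) | (eqᵇ b b ∨ adj W b b)
  ... | true  | true  = refl
  ... | true  | false = refl
  ... | false | _     = refl

π₁ : ∀ m k → Fin (m Data.Nat.* k) → Fin m
π₁ m k x = proj₁ (remQuot {m} k x)

π₂ : ∀ m k → Fin (m Data.Nat.* k) → Fin k
π₂ m k x = proj₂ (remQuot {m} k x)

_⊠_ : Graph → Graph → Graph
G ⊠ W = record
  { n      = n G Data.Nat.* n W
  ; adj    = λ x y → sadj G W (π₁ (n G) (n W) x) (π₂ (n G) (n W) x) (π₁ (n G) (n W) y) (π₂ (n G) (n W) y)
  ; adj-sym    = λ x y → sadj-sym G W (π₁ (n G) (n W) x) (π₂ (n G) (n W) x) (π₁ (n G) (n W) y) (π₂ (n G) (n W) y)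
  ; adj-irrefl = λ x → sadj-irrefl G W (π₁ (n G) (n W) x) (π₂ (n G) (n W) x)
  }

allᵇ : ∀ {A : Set} → (A → Bool) → List A → Bool
allᵇ p = foldr (λ x r → p x ∧ r) true

independentᵇ : (G : Graph) → Subset (n G) → Bool
independentᵇ G S =
  allᵇ (λ u → allᵇ (λ v → not (lookup S u ∧ lookup S v ∧ adj G u v)) (allFin (n G))) (allFin (n G))

allSubsets : (m : ℕ) → List (Subset m)
allSubsets zero    = [] ∷ []
allSubsets (suc m) = map (true ∷_) (allSubsets m) ++ map (false ∷_) (allSubsets m)

α : Graph → ℕ
α G = foldr _⊔_ 0 (map ∣_∣ (filterᵇ (independentᵇ G) (allSubsets (n G))))

-- Average over all endomorphisms σ of G.  Pulling a maximum independent set S of G ⊠ W back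
-- along (σ ∘ g) ⊠ id gives an independent set of H ⊠ W, of size #{(h , w) : (σ (g h) , w) ∈ S}.
-- Composing with automorphisms permutes the endomorphisms, so by vertex-transitivity the number
-- of endomorphisms sending a fixed vertex x to a does not depend on a.  Hence these pullbacks have
-- average size |V(H)| |S| / |V(G)|, and this average is at most α (H ⊠ W).

module Submission where

open import Defs
open import Data.Nat using (ℕ; _*_; _≤_)

open import Data.Bool using (Bool; true; false; _∧_; _∨_; not)
import Data.Bool as Bool
open import Data.Bool.Properties using (T-≡; not-injective)
open import Data.Nat using (zero; suc; _+_; _^_; _⊔_; z≤n; NonZero; >-nonZero)
open import Data.Nat.Properties
  using ( +-mono-≤; *-monoʳ-≤; ≤-trans; ≤-reflexive; m≤m+n; m≤m⊔n; m≤n⊔m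
        ; ⊔-sel; +-identityʳ; +-assoc; *-identityˡ; *-identityʳ; *-comm; *-assoc
        ; *-cancelˡ-≤; +-*-semiring; *-commutativeSemigroup; module ≤-Reasoning)
open import Algebra.Properties.CommutativeSemigroup *-commutativeSemigroup using (x∙yz≈y∙xz)
open import Algebra.Properties.Semiring.Sum +-*-semiring
  using ( sum-syntax; sum-cong-≗; sum-remove; sum-replicate-zero; ∑-comm; ∑-permute
        ; *-distribˡ-sum; *-distribʳ-sum)
open import Data.Fin using (Fin; zero; suc; combine; finToFun; funToFin; _↑ˡ_; _↑ʳ_)
open import Data.Fin.Properties
  using (_≟_; all?; remQuot-combine; finToFun-funToFin; funToFin-finToFin)
open import Data.Fin.Permutation
  using (Permutation′; permutation; _⟨$⟩ʳ_; _⟨$⟩ˡ_; inverseˡ; inverseʳ)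
open import Data.Fin.Subset using (Subset; ∣_∣; ⊥)
open import Data.Fin.Subset.Properties using (∣⊥∣≡0)
open import Data.List using ([]; _∷_; map; foldr; filterᵇ; allFin)
open import Data.List.Relation.Unary.Any using (here; there)
open import Data.List.Membership.Propositional using (_∈_)
open import Data.List.Membership.Propositional.Properties
  using (∈-allFin; ∈-map⁺; ∈-map⁻; ∈-filter⁺; ∈-filter⁻; ∈-++⁺ˡ; ∈-++⁺ʳ; foldr-selective)
open import Data.Vec using ([]; _∷_; lookup; tabulate)
open import Data.Vec.Properties using (lookup∘tabulate; lookup-replicate)
open import Data.Product using (Σ-syntax; _,_; proj₁; proj₂; _×_)
open import Data.Sum using (inj₁; inj₂)
open import Function using (_∘_; _⇔_; mk⇔; Equivalence)
open import Relation.Nullary using (Dec; does; yes; no)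
open import Relation.Nullary.Decidable using (⌊_⌋; T?; _→-dec_; does-⇔; dec-true)
open import Relation.Nullary.Negation using (contradiction)
open import Relation.Binary.PropositionalEquality

𝟙 : Bool → ℕ
𝟙 true  = 1
𝟙 false = 0

𝟙-does-*-mono : ∀ {P : Set} (P? : Dec P) {x y} → (P → x ≤ y) → 𝟙 (does P?) * x ≤ 𝟙 (does P?) * y
𝟙-does-*-mono (yes p) x≤y = *-monoʳ-≤ 1 (x≤y p)
𝟙-does-*-mono (no _)  _   = z≤n

∑-const : ∀ n c → ∑[ i < n ] c ≡ n * c
∑-const zero    c = refl
∑-const (suc n) c = cong (c +_) (∑-const n c)

∑-mono-≤ : ∀ {n} {f g : Fin n → ℕ} → (∀ i → f i ≤ g i) → ∑[ i < n ] f i ≤ ∑[ i < n ] g i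
∑-mono-≤ {zero}  f≤g = z≤n
∑-mono-≤ {suc n} f≤g = +-mono-≤ (f≤g zero) (∑-mono-≤ (f≤g ∘ suc))

term≤∑ : ∀ {n} (f : Fin n → ℕ) i → f i ≤ ∑[ j < n ] f j
term≤∑ {suc n} f i = ≤-trans (m≤m+n (f i) _) (≤-reflexive (sym (sum-remove {i = i} f)))

∑-sift : ∀ {n} (y : Fin n) (f : Fin n → ℕ) → ∑[ a < n ] (𝟙 (does (y ≟ a)) * f a) ≡ f y
∑-sift {suc n} zero    f =
  trans (cong₂ _+_ (*-identityˡ (f zero)) (sum-replicate-zero n)) (+-identityʳ (f zero))
∑-sift {suc n} (suc y) f = ∑-sift y (f ∘ suc)

∑-↑ : ∀ m n (f : Fin (m + n) → ℕ) →
  ∑[ i < m + n ] f i ≡ ∑[ i < m ] f (i ↑ˡ n) + ∑[ j < n ] f (m ↑ʳ j)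
∑-↑ zero    n f = refl
∑-↑ (suc m) n f = trans (cong (f zero +_) (∑-↑ m n (f ∘ suc))) (sym (+-assoc (f zero) _ _))

∑-combine : ∀ m n (f : Fin (m * n) → ℕ) →
  ∑[ i < m * n ] f i ≡ ∑[ a < m ] ∑[ b < n ] f (combine a b)
∑-combine zero    n f = refl
∑-combine (suc m) n f = trans (∑-↑ n (m * n) f)
  (cong (∑[ b < n ] f (combine {suc m} zero b) +_) (∑-combine m n (f ∘ (n ↑ʳ_))))

∑-π₂ : ∀ m n (f : Fin n → ℕ) → ∑[ z < m * n ] f (π₂ m n z) ≡ m * ∑[ b < n ] f b
∑-π₂ m n f = begin
  ∑[ z < m * n ] f (π₂ m n z)                   ≡⟨ ∑-combine m n (f ∘ π₂ m n) ⟩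
  ∑[ a < m ] ∑[ b < n ] f (π₂ m n (combine a b)) ≡⟨ sum-cong-≗ {m} (λ a → sum-cong-≗ {n} λ b →
                                                     cong (f ∘ proj₂) (remQuot-combine a b)) ⟩
  ∑[ a < m ] ∑[ b < n ] f b                     ≡⟨ ∑-const m _ ⟩
  m * ∑[ b < n ] f b                            ∎
  where open ≡-Reasoning

∣∣≡∑ : ∀ {m} (S : Subset m) → ∣ S ∣ ≡ ∑[ i < m ] 𝟙 (lookup S i)
∣∣≡∑ []          = refl
∣∣≡∑ (true ∷ S)  = cong suc (∣∣≡∑ S)
∣∣≡∑ (false ∷ S) = ∣∣≡∑ S

⟨$⟩ʳ-injective : ∀ {n} (π : Permutation′ n) {i j} → π ⟨$⟩ʳ i ≡ π ⟨$⟩ʳ j → i ≡ j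
⟨$⟩ʳ-injective π {i} {j} πi≡πj = begin
  i                   ≡⟨ sym (inverseˡ π) ⟩
  π ⟨$⟩ˡ (π ⟨$⟩ʳ i)  ≡⟨ cong (π ⟨$⟩ˡ_) πi≡πj ⟩
  π ⟨$⟩ˡ (π ⟨$⟩ʳ j)  ≡⟨ inverseˡ π ⟩
  j                   ∎
  where open ≡-Reasoning

module Fibres {K N : ℕ} (w : Fin K → ℕ) (y : Fin K → Fin N) where

  fibre : Fin N → ℕ
  fibre a = ∑[ k < K ] (w k * 𝟙 (does (y k ≟ a)))

  ∑-by-fibres : (F : Fin N → ℕ) → ∑[ k < K ] (w k * F (y k)) ≡ ∑[ a < N ] (fibre a * F a)
  ∑-by-fibres F = begin
    ∑[ k < K ] (w k * F (y k))
      ≡⟨ sum-cong-≗ {K} (λ k → cong (w k *_) (sym (∑-sift (y k) F))) ⟩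
    ∑[ k < K ] (w k * ∑[ a < N ] (𝟙 (does (y k ≟ a)) * F a))
      ≡⟨ sum-cong-≗ {K} (λ k → trans (*-distribˡ-sum {N} (w k) _)
           (sum-cong-≗ {N} λ a → sym (*-assoc (w k) _ (F a)))) ⟩
    ∑[ k < K ] ∑[ a < N ] (w k * 𝟙 (does (y k ≟ a)) * F a)
      ≡⟨ ∑-comm {K} {N} _ ⟩
    ∑[ a < N ] ∑[ k < K ] (w k * 𝟙 (does (y k ≟ a)) * F a)
      ≡⟨ sum-cong-≗ {N} (λ a → sym (*-distribʳ-sum {K} (F a) _)) ⟩
    ∑[ a < N ] (fibre a * F a) ∎
    where open ≡-Reasoning

  fibre-invariant : (π : Permutation′ K) (τ : Permutation′ N) →
    (∀ k → w (π ⟨$⟩ʳ k) ≡ w k) → (∀ k → y (π ⟨$⟩ʳ k) ≡ τ ⟨$⟩ʳ y k) →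
    ∀ a → fibre (τ ⟨$⟩ʳ a) ≡ fibre a
  fibre-invariant π τ wπ≡w yπ≡τy a = begin
    fibre (τ ⟨$⟩ʳ a)
      ≡⟨ ∑-permute {K} {K} (λ k → w k * 𝟙 (does (y k ≟ τ ⟨$⟩ʳ a))) π ⟩
    ∑[ k < K ] (w (π ⟨$⟩ʳ k) * 𝟙 (does (y (π ⟨$⟩ʳ k) ≟ τ ⟨$⟩ʳ a)))
      ≡⟨ sum-cong-≗ {K} (λ k → cong₂ (λ m b → m * 𝟙 (does (b ≟ τ ⟨$⟩ʳ a))) (wπ≡w k) (yπ≡τy k)) ⟩
    ∑[ k < K ] (w k * 𝟙 (does (τ ⟨$⟩ʳ y k ≟ τ ⟨$⟩ʳ a)))
      ≡⟨ sum-cong-≗ {K} (λ k → cong (λ b → w k * 𝟙 b)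
           (does-⇔ (mk⇔ (⟨$⟩ʳ-injective τ) (cong (τ ⟨$⟩ʳ_))) (τ ⟨$⟩ʳ y k ≟ τ ⟨$⟩ʳ a) (y k ≟ a))) ⟩
    fibre a ∎
    where open ≡-Reasoning

  ∑-uniform-fibres : ∀ c → (∀ a → fibre a ≡ c) → (F : Fin N → ℕ) →
    N * ∑[ k < K ] (w k * F (y k)) ≡ ∑[ k < K ] w k * ∑[ a < N ] F a
  ∑-uniform-fibres c fibre≡c F = begin
    N * ∑[ k < K ] (w k * F (y k)) ≡⟨ cong (N *_) (weighted-sum F) ⟩
    N * (c * ∑[ a < N ] F a)       ≡⟨ sym (*-assoc N c _) ⟩
    N * c * ∑[ a < N ] F a         ≡⟨ cong (_* ∑[ a < N ] F a) (*-comm N c) ⟩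
    c * N * ∑[ a < N ] F a         ≡⟨ cong (_* ∑[ a < N ] F a) (sym total-weight) ⟩
    ∑[ k < K ] w k * ∑[ a < N ] F a ∎
    where
    open ≡-Reasoning
    weighted-sum : ∀ F → ∑[ k < K ] (w k * F (y k)) ≡ c * ∑[ a < N ] F a
    weighted-sum F = begin
      ∑[ k < K ] (w k * F (y k))  ≡⟨ ∑-by-fibres F ⟩
      ∑[ a < N ] (fibre a * F a)  ≡⟨ sum-cong-≗ {N} (λ a → cong (_* F a) (fibre≡c a)) ⟩
      ∑[ a < N ] (c * F a)        ≡⟨ sym (*-distribˡ-sum {N} c F) ⟩
      c * ∑[ a < N ] F a          ∎
    total-weight : ∑[ k < K ] w k ≡ c * N
    total-weight = begin
      ∑[ k < K ] w k        ≡⟨ sum-cong-≗ {K} (λ k → sym (*-identityʳ (w k))) ⟩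
      ∑[ k < K ] (w k * 1)  ≡⟨ weighted-sum (λ _ → 1) ⟩
      c * ∑[ a < N ] 1      ≡⟨ cong (c *_) (trans (∑-const N 1) (*-identityʳ N)) ⟩
      c * N                 ∎

IsHom : (H G : Graph) → (Fin (n H) → Fin (n G)) → Set
IsHom H G f = ∀ u v → adj H u v ≡ true → adj G (f u) (f v) ≡ true

isHom? : ∀ H G f → Dec (IsHom H G f)
isHom? H G f = all? λ u → all? λ v → (adj H u v Bool.≟ true) →-dec (adj G (f u) (f v) Bool.≟ true)

IsHom-resp-≗ : ∀ {H G} {f g : Fin (n H) → Fin (n G)} → f ≗ g → IsHom H G f → IsHom H G g
IsHom-resp-≗ {G = G} f≗g f-hom u v uv =
  subst₂ (λ a b → adj G a b ≡ true) (f≗g u) (f≗g v) (f-hom u v uv)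

IsHom-postcompose-aut : ∀ {H G τ} → IsAut G τ → (f : Fin (n H) → Fin (n G)) →
  IsHom H G ((τ ⟨$⟩ʳ_) ∘ f) ⇔ IsHom H G f
IsHom-postcompose-aut τ-aut f = mk⇔
  (λ τf-hom u v uv → trans (sym (τ-aut (f u) (f v))) (τf-hom u v uv))
  (λ f-hom u v uv → trans (τ-aut (f u) (f v)) (f-hom u v uv))

funToFin-cong : ∀ {m n} {f g : Fin m → Fin n} → f ≗ g → funToFin f ≡ funToFin g
funToFin-cong {zero}  f≗g = refl
funToFin-cong {suc m} f≗g = cong₂ combine (f≗g zero) (funToFin-cong (f≗g ∘ suc))

postcompose : ∀ {m n} → Permutation′ n → Permutation′ (n ^ m)
postcompose {m} {n} τ = permutation (along (τ ⟨$⟩ʳ_)) (along (τ ⟨$⟩ˡ_))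
  (along-inverse (τ ⟨$⟩ʳ_) (τ ⟨$⟩ˡ_) (λ _ → inverseʳ τ))
  (along-inverse (τ ⟨$⟩ˡ_) (τ ⟨$⟩ʳ_) (λ _ → inverseˡ τ))
  where
  along : (Fin n → Fin n) → Fin (n ^ m) → Fin (n ^ m)
  along ρ k = funToFin (ρ ∘ finToFun {n} {m} k)
  along-inverse : ∀ ρ ρ′ → (∀ i → ρ (ρ′ i) ≡ i) → ∀ k → along ρ (along ρ′ k) ≡ k
  along-inverse ρ ρ′ ρρ′≡id k = trans
    (funToFin-cong {m} λ i → trans (cong ρ (finToFun-funToFin (ρ′ ∘ finToFun k) i)) (ρρ′≡id _))
    (funToFin-finToFin {m} k)

finToFun-postcompose : ∀ {m n} (τ : Permutation′ n) (k : Fin (n ^ m)) →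
  finToFun {n} {m} (postcompose {m} τ ⟨$⟩ʳ k) ≗ (τ ⟨$⟩ʳ_) ∘ finToFun k
finToFun-postcompose {m} {n} τ k = finToFun-funToFin ((τ ⟨$⟩ʳ_) ∘ finToFun {n} {m} k)

-- Self-maps of V(G) are enumerated as Fin (|V(G)| ^ |V(G)|) through finToFun; averaging over
-- endomorphisms rather than automorphisms needs no enumeration of the automorphism group.
module Endomorphisms (G : Graph) where

  selfMap : Fin (n G ^ n G) → Fin (n G) → Fin (n G)
  selfMap = finToFun

  endo : Fin (n G ^ n G) → ℕ
  endo k = 𝟙 (does (isHom? G G (selfMap k)))

  #endo : ℕ
  #endo = ∑[ k < n G ^ n G ] endo k

  endo-postcompose : ∀ τ → IsAut G τ → ∀ k → endo (postcompose {n G} τ ⟨$⟩ʳ k) ≡ endo k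
  endo-postcompose τ τ-aut k = cong 𝟙 (does-⇔ (mk⇔ to from) (isHom? G G _) (isHom? G G _))
    where
    τ∘k-hom⇔k-hom : IsHom G G ((τ ⟨$⟩ʳ_) ∘ selfMap k) ⇔ IsHom G G (selfMap k)
    τ∘k-hom⇔k-hom = IsHom-postcompose-aut {G} {G} {τ} τ-aut (selfMap k)
    to : IsHom G G (selfMap (postcompose {n G} τ ⟨$⟩ʳ k)) → IsHom G G (selfMap k)
    to = Equivalence.to τ∘k-hom⇔k-hom ∘ IsHom-resp-≗ {G} {G} (finToFun-postcompose {n G} τ k)
    from : IsHom G G (selfMap k) → IsHom G G (selfMap (postcompose {n G} τ ⟨$⟩ʳ k))
    from = IsHom-resp-≗ {G} {G} (sym ∘ finToFun-postcompose {n G} τ k)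
         ∘ Equivalence.from τ∘k-hom⇔k-hom

  #endo-nonZero : NonZero #endo
  #endo-nonZero = >-nonZero (subst (_≤ #endo) identity-is-endo (term≤∑ endo identity))
    where
    identity : Fin (n G ^ n G)
    identity = funToFin {n G} (λ i → i)
    identity-is-endo : endo identity ≡ 1
    identity-is-endo = cong 𝟙 (dec-true (isHom? G G (selfMap identity))
      (IsHom-resp-≗ {G} {G} (sym ∘ finToFun-funToFin (λ i → i)) (λ u v uv → uv)))

  ∑-endo-average : VertexTransitive G → ∀ x (F : Fin (n G) → ℕ) →
    n G * ∑[ k < n G ^ n G ] (endo k * F (selfMap k x)) ≡ #endo * ∑[ a < n G ] F a
  ∑-endo-average vt x = ∑-uniform-fibres (fibre x) fibre≡fibre-x
    where
    open Fibres endo (λ k → selfMap k x)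
    fibre≡fibre-x : ∀ a → fibre a ≡ fibre x
    fibre≡fibre-x a with vt x a
    ... | τ , τ-aut , refl = fibre-invariant (postcompose {n G} τ) τ
      (endo-postcompose τ τ-aut) (λ k → finToFun-postcompose {n G} τ k x) x

Independent : (G : Graph) → Subset (n G) → Set
Independent G S = ∀ u v → lookup S u ≡ true → lookup S v ≡ true → adj G u v ≡ false

⊥-independent : ∀ G → Independent G ⊥
⊥-independent G u v u∈⊥ _ = contradiction (trans (sym (lookup-replicate u false)) u∈⊥) λ ()

allᵇ-true⁻ : ∀ {A : Set} (p : A → Bool) {x xs} → allᵇ p xs ≡ true → x ∈ xs → p x ≡ true
allᵇ-true⁻ p {xs = y ∷ xs} all-p x∈ with p y in py | x∈
... | true | here refl = py
... | true | there x∈xs = allᵇ-true⁻ p all-p x∈xs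

allᵇ-true⁺ : ∀ {A : Set} (p : A → Bool) xs → (∀ x → p x ≡ true) → allᵇ p xs ≡ true
allᵇ-true⁺ p []       p-true = refl
allᵇ-true⁺ p (x ∷ xs) p-true rewrite p-true x = allᵇ-true⁺ p xs p-true

independentᵇ⇒Independent : ∀ G S → independentᵇ G S ≡ true → Independent G S
independentᵇ⇒Independent G S ind u v u∈S v∈S = not-injective
  (subst₂ (λ a b → not (a ∧ b ∧ adj G u v) ≡ true) u∈S v∈S
    (allᵇ-true⁻ _ (allᵇ-true⁻ _ ind (∈-allFin u)) (∈-allFin v)))

Independent⇒independentᵇ : ∀ G S → Independent G S → independentᵇ G S ≡ true
Independent⇒independentᵇ G S ind =
  allᵇ-true⁺ _ (allFin (n G)) λ u → allᵇ-true⁺ _ (allFin (n G)) λ v → no-edge u v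
  where
  no-edge : ∀ u v → not (lookup S u ∧ lookup S v ∧ adj G u v) ≡ true
  no-edge u v with lookup S u in u∈S | lookup S v in v∈S
  ... | false | _     = refl
  ... | true  | false = refl
  ... | true  | true  rewrite ind u v u∈S v∈S = refl

∈-allSubsets : ∀ {m} (S : Subset m) → S ∈ allSubsets m
∈-allSubsets []                = here refl
∈-allSubsets (true ∷ S)        = ∈-++⁺ˡ (∈-map⁺ (true ∷_) (∈-allSubsets S))
∈-allSubsets {suc m} (false ∷ S) =
  ∈-++⁺ʳ (map (true ∷_) (allSubsets m)) (∈-map⁺ (false ∷_) (∈-allSubsets S))

∈⇒≤foldr-⊔ : ∀ {x xs} → x ∈ xs → x ≤ foldr _⊔_ 0 xs
∈⇒≤foldr-⊔ (here refl)  = m≤m⊔n _ _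
∈⇒≤foldr-⊔ (there x∈xs) = ≤-trans (∈⇒≤foldr-⊔ x∈xs) (m≤n⊔m _ _)

Independent⇒≤α : ∀ G S → Independent G S → ∣ S ∣ ≤ α G
Independent⇒≤α G S ind = ∈⇒≤foldr-⊔ (∈-map⁺ ∣_∣
  (∈-filter⁺ (T? ∘ independentᵇ G) (∈-allSubsets S)
    (Equivalence.from T-≡ (Independent⇒independentᵇ G S ind))))

maximum-independent : ∀ G → Σ[ S ∈ Subset (n G) ] Independent G S × ∣ S ∣ ≡ α G
maximum-independent G
  with foldr-selective ⊔-sel 0 (map ∣_∣ (filterᵇ (independentᵇ G) (allSubsets (n G))))
... | inj₁ α≡0 = ⊥ , ⊥-independent G , trans (∣⊥∣≡0 (n G)) (sym α≡0)
... | inj₂ α∈ with ∈-map⁻ ∣_∣ α∈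
...   | S , S∈ , α≡∣S∣ = S
  , independentᵇ⇒Independent G S
      (Equivalence.to T-≡ (proj₂ (∈-filter⁻ (T? ∘ independentᵇ G) {xs = allSubsets (n G)} S∈)))
  , sym α≡∣S∣

⊠-adj : (G W : Graph) → Fin (n G) → Fin (n W) → Fin (n G) → Fin (n W) → Bool
⊠-adj G W a b c d = (⌊ a ≟ c ⌋ ∨ adj G a c) ∧ (⌊ b ≟ d ⌋ ∨ adj W b d) ∧ not (⌊ a ≟ c ⌋ ∧ ⌊ b ≟ d ⌋)

adj-⊠-combine : ∀ G W a b c d → adj (G ⊠ W) (combine a b) (combine c d) ≡ ⊠-adj G W a b c d
adj-⊠-combine G W a b c d =
  cong₂ (λ p q → ⊠-adj G W (proj₁ p) (proj₂ p) (proj₁ q) (proj₂ q))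
    (remQuot-combine a b) (remQuot-combine c d)

⊠-adj-IsHom : ∀ {H G} W {f} → IsHom H G f →
  ∀ a b c d → ⊠-adj H W a b c d ≡ true → ⊠-adj G W (f a) b (f c) d ≡ true
⊠-adj-IsHom {H} {G} W {f} f-hom a b c d = go (a ≟ c) (f a ≟ f c)
  where
  B E : Bool
  B = ⌊ b ≟ d ⌋ ∨ adj W b d
  E = ⌊ b ≟ d ⌋
  go : (a≟c : Dec (a ≡ c)) (fa≟fc : Dec (f a ≡ f c)) →
    (⌊ a≟c ⌋ ∨ adj H a c) ∧ B ∧ not (⌊ a≟c ⌋ ∧ E) ≡ true →
    (⌊ fa≟fc ⌋ ∨ adj G (f a) (f c)) ∧ B ∧ not (⌊ fa≟fc ⌋ ∧ E) ≡ true
  go (yes _)    (yes _)        = λ h → h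
  go (yes refl) (no fa≢fa)     = contradiction refl fa≢fa
  go (no _)     (yes fa≡fc) with adj H a c in ac
  ... | true  = λ _ → contradiction (trans (sym (adj-irrefl G (f c)))
    (subst (λ x → adj G x (f c) ≡ true) fa≡fc (f-hom a c ac))) λ ()
  ... | false = λ ()
  go (no _)     (no _)      with adj H a c in ac
  ... | true  rewrite f-hom a c ac = λ h → h
  ... | false = λ ()

⊠-mapˡ : ∀ {H G} → (Fin (n H) → Fin (n G)) → (W : Graph) → Fin (n (H ⊠ W)) → Fin (n (G ⊠ W))
⊠-mapˡ {H} f W z = combine (f (π₁ (n H) (n W) z)) (π₂ (n H) (n W) z)

IsHom-⊠-mapˡ : ∀ {H G} W {f} → IsHom H G f → IsHom (H ⊠ W) (G ⊠ W) (⊠-mapˡ {H} {G} f W)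
IsHom-⊠-mapˡ {H} {G} W {f} f-hom z z′ zz′ =
  trans (adj-⊠-combine G W (f a) b (f c) d) (⊠-adj-IsHom {H} {G} W {f} f-hom a b c d zz′)
  where
  a = π₁ (n H) (n W) z
  b = π₂ (n H) (n W) z
  c = π₁ (n H) (n W) z′
  d = π₂ (n H) (n W) z′

preimage : ∀ {m k} → (Fin m → Fin k) → Subset k → Subset m
preimage f S = tabulate (lookup S ∘ f)

Independent-preimage : ∀ {H G f S} → IsHom H G f → Independent G S → Independent H (preimage f S)
Independent-preimage {H} {G} {f} {S} f-hom S-ind u v u∈ v∈ with adj H u v in uv
... | false = refl
... | true  = contradiction
  (trans (sym (S-ind (f u) (f v) (∈preimage u u∈) (∈preimage v v∈))) (f-hom u v uv)) λ ()
  where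
  ∈preimage : ∀ x → lookup (preimage f S) x ≡ true → lookup S (f x) ≡ true
  ∈preimage x = trans (sym (lookup∘tabulate (lookup S ∘ f) x))

module Pullbacks (G H W : Graph) (g : Fin (n H) → Fin (n G)) (S : Subset (n (G ⊠ W))) where

  open Endomorphisms G

  pullback : Fin (n G ^ n G) → Subset (n (H ⊠ W))
  pullback k = preimage (⊠-mapˡ {H} {G} (selfMap k ∘ g) W) S

  endo*∣pullback∣≤endo*α : IsHom H G g → Independent (G ⊠ W) S →
    ∀ k → endo k * ∣ pullback k ∣ ≤ endo k * α (H ⊠ W)
  endo*∣pullback∣≤endo*α g-hom S-ind k = 𝟙-does-*-mono (isHom? G G (selfMap k)) λ k-hom →
    Independent⇒≤α (H ⊠ W) (pullback k)
      (Independent-preimage {H ⊠ W} {G ⊠ W} {⊠-mapˡ {H} {G} (selfMap k ∘ g) W} {S}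
        (IsHom-⊠-mapˡ {H} {G} W {selfMap k ∘ g} λ u v uv → k-hom (g u) (g v) (g-hom u v uv)) S-ind)

  private
    s : Fin (n G) → Fin (n W) → ℕ
    s a b = 𝟙 (lookup S (combine a b))
    x : Fin (n H * n W) → Fin (n G)
    x z = g (π₁ (n H) (n W) z)
    w : Fin (n H * n W) → Fin (n W)
    w z = π₂ (n H) (n W) z

  ∣pullback∣ : ∀ k → ∣ pullback k ∣ ≡ ∑[ z < n H * n W ] s (selfMap k (x z)) (w z)
  ∣pullback∣ k = trans (∣∣≡∑ (pullback k)) (sum-cong-≗ {n H * n W} λ z → cong 𝟙 (lookup∘tabulate _ z))

  ∣S∣≡∑∑ : ∣ S ∣ ≡ ∑[ b < n W ] ∑[ a < n G ] s a b
  ∣S∣≡∑∑ = trans (∣∣≡∑ S) (trans (∑-combine (n G) (n W) _) (∑-comm {n G} {n W} s))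

  ∑-endo*∣pullback∣ : VertexTransitive G →
    n G * ∑[ k < n G ^ n G ] (endo k * ∣ pullback k ∣) ≡ #endo * (∣ S ∣ * n H)
  ∑-endo*∣pullback∣ vt = begin
    n G * ∑[ k < n G ^ n G ] (endo k * ∣ pullback k ∣)
      ≡⟨ cong (n G *_) (sum-cong-≗ {n G ^ n G} λ k →
           trans (cong (endo k *_) (∣pullback∣ k)) (*-distribˡ-sum {n H * n W} (endo k) _)) ⟩
    n G * ∑[ k < n G ^ n G ] ∑[ z < n H * n W ] (endo k * s (selfMap k (x z)) (w z))
      ≡⟨ cong (n G *_) (∑-comm {n G ^ n G} {n H * n W} _) ⟩
    n G * ∑[ z < n H * n W ] ∑[ k < n G ^ n G ] (endo k * s (selfMap k (x z)) (w z))
      ≡⟨ *-distribˡ-sum {n H * n W} (n G) _ ⟩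
    ∑[ z < n H * n W ] (n G * ∑[ k < n G ^ n G ] (endo k * s (selfMap k (x z)) (w z)))
      ≡⟨ sum-cong-≗ {n H * n W} (λ z → ∑-endo-average vt (x z) (λ a → s a (w z))) ⟩
    ∑[ z < n H * n W ] (#endo * ∑[ a < n G ] s a (w z))
      ≡⟨ sym (*-distribˡ-sum {n H * n W} #endo _) ⟩
    #endo * ∑[ z < n H * n W ] ∑[ a < n G ] s a (w z)
      ≡⟨ cong (#endo *_) (∑-π₂ (n H) (n W) (λ b → ∑[ a < n G ] s a b)) ⟩
    #endo * (n H * ∑[ b < n W ] ∑[ a < n G ] s a b)
      ≡⟨ cong (λ t → #endo * (n H * t)) (sym ∣S∣≡∑∑) ⟩
    #endo * (n H * ∣ S ∣)
      ≡⟨ cong (#endo *_) (*-comm (n H) ∣ S ∣) ⟩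
    #endo * (∣ S ∣ * n H) ∎
    where open ≡-Reasoning

lemma9 : (G H : Graph) → Hom H G → VertexTransitive G →
    (W : Graph) → α (G ⊠ W) * ∣V∣ H ≤ ∣V∣ G * α (H ⊠ W)
lemma9 G H (g , g-hom) vt W with maximum-independent (G ⊠ W)
... | S , S-ind , ∣S∣≡α = subst (λ t → t * n H ≤ n G * α (H ⊠ W)) ∣S∣≡α
  (*-cancelˡ-≤ #endo {{#endo-nonZero}} (begin
    #endo * (∣ S ∣ * n H)
      ≡⟨ sym (∑-endo*∣pullback∣ vt) ⟩
    n G * ∑[ k < n G ^ n G ] (endo k * ∣ pullback k ∣)
      ≤⟨ *-monoʳ-≤ (n G) (∑-mono-≤ (endo*∣pullback∣≤endo*α g-hom S-ind)) ⟩
    n G * ∑[ k < n G ^ n G ] (endo k * α (H ⊠ W))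
      ≡⟨ cong (n G *_) (sym (*-distribʳ-sum {n G ^ n G} (α (H ⊠ W)) endo)) ⟩
    n G * (#endo * α (H ⊠ W))
      ≡⟨ x∙yz≈y∙xz (n G) #endo (α (H ⊠ W)) ⟩
    #endo * (n G * α (H ⊠ W)) ∎))
  where
  open Endomorphisms G
  open Pullbacks G H W g S
  open ≤-Reasoning
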